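{- Let $\Phi$ be the fixed point beginning with $0$ of the morphism $0\mapsto 00101$, $1\mapsto 11011$. For each integer $C\ge4$ let $N_C=132\cdot5^{C-4}$. Then for all $n\ge N_C$, \[\left\{\left(\left\lfloor \tfrac{n}{3}\right\rfloor+D,\ n-\left\lfloor\tfrac n3\right\rfloor-D\right): D\in\mathbb{Z},\ -C\le D\le C\right\}\subseteq \psi(\mathcal{L}_{n,\Phi}).\]
   Context: $\mathcal{L}_{n,\Phi}$ is the set of factors of length $n$ of $\Phi$; for a binary word $u$, $\psi(u)=(|u|_0,|u|_1)$ is its Parikh vector, and $\psi(\mathcal{L}_{n,\Phi})=\{\psi(u):u\in\mathcal{L}_{n,\Phi}\}$. -}

module Defs where

open import Data.Nat using (ℕ; zero; suc; _+_; _*_; _^_; _∸_)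
open import Data.Fin using (Fin; zero; suc)
open import Data.List using (List; []; _∷_; concatMap; length; filter; map; upTo)
open import Data.Nat.Properties using (_≟_)
open import Data.Fin using (toℕ)
open import Relation.Nullary using (yes; no)
open import Data.Product using (_×_; _,_)

Letter : Set
Letter = Fin 2

σ : Letter → List Letter
σ zero    = zero ∷ zero ∷ suc zero ∷ zero ∷ suc zero ∷ []
σ (suc _) = suc zero ∷ suc zero ∷ zero ∷ suc zero ∷ suc zero ∷ []

σ* : List Letter → List Letter
σ* = concatMap σ

iterσ : ℕ → List Letter → List Letter
iterσ zero    w = w
iterσ (suc k) w = σ* (iterσ k w)

-- Φ as an infinite word ℕ → Letter: the i-th letter (0-indexed) of the fixed
-- point starting with 0, read off σ^(i+1)(0), which has length 5^(i+1) > i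
-- and is a prefix of Φ.  (The default value is never used.)
-- i-th element of a list, with a default for out-of-range indices
at : List Letter → ℕ → Letter
at []      _       = zero
at (x ∷ _) zero    = x
at (_ ∷ u) (suc i) = at u i

Φ : ℕ → Letter
Φ i = at (iterσ (suc i) (zero ∷ [])) i

factor : ℕ → ℕ → List Letter
factor i n = map (λ j → Φ (i + j)) (upTo n)

count : Letter → List Letter → ℕ
count a []       = 0
count a (b ∷ u) with toℕ a ≟ toℕ b
... | yes _ = suc (count a u)
... | no  _ = count a u

ψ : List Letter → ℕ × ℕ
ψ u = count zero u , count (suc zero) u

N : ℕ → ℕ
N C = 132 * 5 ^ (C ∸ 4)

zero' one' : Letter
zero' = zero
one'  = suc zero

module Submission where

-- Write z(i,n) for the number of 0s in the length-n factor of Φ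
-- starting at position i; the Parikh vector of that factor is (z(i,n), n - z(i,n)).
--   * Sliding a window one step changes z by at most one, so by a discrete
--     intermediate value theorem every value between two attained values of
--     z(·,n) is attained.  It therefore suffices to find, for n ≥ N_C, one
--     window with at least ⌊n/3⌋ + C zeros ("rich") and one with at most
--     ⌊n/3⌋ - C zeros ("poor").
--   * Since Φ = σ(Φ) and σ(x) contains 1 + 2·[x = 0] zeros, a window of length m
--     at position i is mapped to a window of length 5m at position 5i with
--     z(5i,5m) = m + 2·z(i,m).  Extending by r < 5 letters, a rich (poor) window
--     for (C, m) yields a rich (poor) window for (C + 1, 5m + r), as long as C ≥ 4.
--   * For C = 4 the base range 132 ≤ n < 660 is certified by computation on the
--     prefix σ⁶(0); strong induction on n then gives all n ≥ 132, and induction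
--     on C gives all n ≥ N_C = 132·5^(C-4).

open import Defs
open import Data.Bool using (Bool; true; _∧_; T)
open import Data.Bool.Properties using (T-∧)
open import Data.Empty using (⊥-elim)
import Data.Fin as Fin
open import Data.List using (List; []; _∷_; _++_; take; drop; length; applyUpTo)
open import Data.List.Properties
  using (length-++; length-applyUpTo; length-drop; map-upTo; concatMap-++; ++-assoc; ++-identityʳ)
open import Data.Nat
open import Data.Nat.DivMod using (m≡m%n+[m/n]*n; m%n<n; m/n<m; /-monoˡ-≤; m*n/n≡m; m/n*n≤m)
open import Data.Nat.Induction using (<-rec)
open import Data.Nat.Properties
open import Data.Nat.Tactic.RingSolver using (solve)
open import Data.Product using (_×_; _,_; ∃-syntax; proj₁; proj₂)
open import Data.Sum using (inj₁; inj₂)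
open import Data.Unit using (tt)
open import Function using (_∘_)
open import Function.Bundles using (Equivalence)
open import Relation.Binary.PropositionalEquality
open import Relation.Nullary using (yes; no)

-- Windows of an infinite binary word and their zero counts

Word : Set
Word = ℕ → Letter

isZero : Letter → ℕ
isZero Fin.zero    = 1
isZero (Fin.suc _) = 0

zeros : Word → ℕ → ℕ → ℕ
zeros w i zero    = 0
zeros w i (suc n) = isZero (w i) + zeros w (suc i) n

count-zero-∷ : ∀ x u → count zero' (x ∷ u) ≡ isZero x + count zero' u
count-zero-∷ Fin.zero          u = refl
count-zero-∷ (Fin.suc Fin.zero) u = refl

count-zero+one : ∀ u → count zero' u + count one' u ≡ length u
count-zero+one []                   = refl
count-zero+one (Fin.zero ∷ u)       = cong suc (count-zero+one u)
count-zero+one (Fin.suc Fin.zero ∷ u) =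
  trans (+-suc (count zero' u) (count one' u)) (cong suc (count-zero+one u))

zeros-shift : ∀ w k i n → zeros w (k + i) n ≡ zeros (λ j → w (k + j)) i n
zeros-shift w k i zero    = refl
zeros-shift w k i (suc n) =
  cong (isZero (w (k + i)) +_) (trans (cong (λ p → zeros w p n) (sym (+-suc k i))) (zeros-shift w k (suc i) n))

count-applyUpTo : ∀ (f : Word) n → count zero' (applyUpTo f n) ≡ zeros f 0 n
count-applyUpTo f zero    = refl
count-applyUpTo f (suc n) = trans (count-zero-∷ (f 0) (applyUpTo (λ j → f (suc j)) n))
  (cong (isZero (f 0) +_) (trans (count-applyUpTo (λ j → f (suc j)) n) (sym (zeros-shift f 1 0 n))))

zeros-at : ∀ w i n xs → n ≤ length xs → (∀ j → j < n → w (i + j) ≡ at xs j) →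
           zeros w i n ≡ count zero' (take n xs)
zeros-at w i zero    xs       _         _     = refl
zeros-at w i (suc n) (x ∷ xs) (s≤s n≤l) agree = trans
  (cong₂ _+_ (cong isZero (trans (cong w (sym (+-identityʳ i))) (agree 0 (s≤s z≤n))))
             (zeros-at w (suc i) n xs n≤l λ j j<n → trans (cong w (sym (+-suc i j))) (agree (suc j) (s≤s j<n))))
  (sym (count-zero-∷ x (take n xs)))

ψ-factor : ∀ i n → proj₁ (ψ (factor i n)) ≡ zeros Φ i n × proj₂ (ψ (factor i n)) + zeros Φ i n ≡ n
ψ-factor i n = zeros-count , (begin
    count one' (factor i n) + zeros Φ i n               ≡⟨ +-comm _ (zeros Φ i n) ⟩
    zeros Φ i n + count one' (factor i n)               ≡⟨ cong (_+ count one' (factor i n)) (sym zeros-count) ⟩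
    count zero' (factor i n) + count one' (factor i n)  ≡⟨ count-zero+one (factor i n) ⟩
    length (factor i n)                                 ≡⟨ cong length (map-upTo _ n) ⟩
    length (applyUpTo (λ j → Φ (i + j)) n)              ≡⟨ length-applyUpTo _ n ⟩
    n                                                   ∎)
  where
  open ≡-Reasoning
  zeros-count : count zero' (factor i n) ≡ zeros Φ i n
  zeros-count = begin
    count zero' (factor i n)                          ≡⟨ cong (count zero') (map-upTo _ n) ⟩
    count zero' (applyUpTo (λ j → Φ (i + j)) n)       ≡⟨ count-applyUpTo _ n ⟩
    zeros (λ j → Φ (i + j)) 0 n                       ≡⟨ sym (zeros-shift Φ i 0 n) ⟩
    zeros Φ (i + 0) n                                 ≡⟨ cong (λ p → zeros Φ p n) (+-identityʳ i) ⟩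
    zeros Φ i n                                       ∎

isZero≤1 : ∀ x → isZero x ≤ 1
isZero≤1 Fin.zero    = ≤-refl
isZero≤1 (Fin.suc _) = z≤n

zeros-++ : ∀ w i a b → zeros w i (a + b) ≡ zeros w i a + zeros w (i + a) b
zeros-++ w i zero    b = cong (λ p → zeros w p b) (sym (+-identityʳ i))
zeros-++ w i (suc a) b = begin
  isZero (w i) + zeros w (suc i) (a + b)
    ≡⟨ cong (isZero (w i) +_) (zeros-++ w (suc i) a b) ⟩
  isZero (w i) + (zeros w (suc i) a + zeros w (suc i + a) b)
    ≡⟨ sym (+-assoc (isZero (w i)) _ _) ⟩
  zeros w i (suc a) + zeros w (suc i + a) b
    ≡⟨ cong (λ p → zeros w i (suc a) + zeros w p b) (sym (+-suc i a)) ⟩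
  zeros w i (suc a) + zeros w (i + suc a) b
    ∎
  where open ≡-Reasoning

zeros≤length : ∀ w i n → zeros w i n ≤ n
zeros≤length w i zero    = z≤n
zeros≤length w i (suc n) = +-mono-≤ (isZero≤1 (w i)) (zeros≤length w (suc i) n)

zeros-extend-≥ : ∀ w i a b → zeros w i a ≤ zeros w i (a + b)
zeros-extend-≥ w i a b = ≤-trans (m≤m+n _ _) (≤-reflexive (sym (zeros-++ w i a b)))

zeros-extend-≤ : ∀ w i a b → zeros w i (a + b) ≤ zeros w i a + b
zeros-extend-≤ w i a b = ≤-trans (≤-reflexive (zeros-++ w i a b)) (+-monoʳ-≤ _ (zeros≤length w (i + a) b))

zeros-slide-up : ∀ w i n → zeros w (suc i) n ≤ suc (zeros w i n)
zeros-slide-up w i n = begin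
  zeros w (suc i) n       ≤⟨ m≤n+m _ (isZero (w i)) ⟩
  zeros w i (suc n)       ≡⟨ cong (zeros w i) (+-comm 1 n) ⟩
  zeros w i (n + 1)       ≤⟨ zeros-extend-≤ w i n 1 ⟩
  zeros w i n + 1         ≡⟨ +-comm _ 1 ⟩
  suc (zeros w i n)       ∎
  where open ≤-Reasoning

zeros-slide-down : ∀ w i n → zeros w i n ≤ suc (zeros w (suc i) n)
zeros-slide-down w i n = begin
  zeros w i n                       ≤⟨ zeros-extend-≥ w i n 1 ⟩
  zeros w i (n + 1)                 ≡⟨ cong (zeros w i) (+-comm n 1) ⟩
  isZero (w i) + zeros w (suc i) n  ≤⟨ +-monoˡ-≤ _ (isZero≤1 (w i)) ⟩
  suc (zeros w (suc i) n)           ∎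
  where open ≤-Reasoning

-- Discrete intermediate value theorem

ivt-rising : (f : ℕ → ℕ) → (∀ i → f (suc i) ≤ suc (f i)) →
             ∀ {t} a k → f a ≤ t → t ≤ f (a + k) → ∃[ i ] f i ≡ t
ivt-rising f rise a zero    fa≤t t≤f = a , ≤-antisym fa≤t (subst (λ p → _ ≤ f p) (+-identityʳ a) t≤f)
ivt-rising f rise {t} a (suc k) fa≤t t≤f with f a ≟ t
... | yes fa≡t = a , fa≡t
... | no  fa≢t = ivt-rising f rise (suc a) k (≤-trans (rise a) (≤∧≢⇒< fa≤t fa≢t))
                   (subst (λ p → t ≤ f p) (+-suc a k) t≤f)

ivt-falling : (f : ℕ → ℕ) → (∀ i → f i ≤ suc (f (suc i))) →
              ∀ {t} a k → t ≤ f a → f (a + k) ≤ t → ∃[ i ] f i ≡ t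
ivt-falling f fall a zero    t≤fa f≤t = a , ≤-antisym (subst (λ p → f p ≤ _) (+-identityʳ a) f≤t) t≤fa
ivt-falling f fall {t} a (suc k) t≤fa f≤t with f a ≟ t
... | yes fa≡t = a , fa≡t
... | no  fa≢t = ivt-falling f fall (suc a) k (s≤s⁻¹ (≤-trans (≤∧≢⇒< t≤fa (fa≢t ∘ sym)) (fall a)))
                   (subst (λ p → f p ≤ t) (+-suc a k) f≤t)

ivt : (f : ℕ → ℕ) → (∀ i → f (suc i) ≤ suc (f i)) → (∀ i → f i ≤ suc (f (suc i))) →
      ∀ {t} a b → f a ≤ t → t ≤ f b → ∃[ i ] f i ≡ t
ivt f rise fall a b fa≤t t≤fb with ≤-total a b
... | inj₁ a≤b = ivt-rising f rise a (b ∸ a) fa≤t (subst (λ p → _ ≤ f p) (sym (m+[n∸m]≡n a≤b)) t≤fb)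
... | inj₂ b≤a = ivt-falling f fall b (a ∸ b) t≤fb (subst (λ p → f p ≤ _) (sym (m+[n∸m]≡n b≤a)) fa≤t)

zeros-ivt : ∀ w n {t} a b → zeros w a n ≤ t → t ≤ zeros w b n → ∃[ i ] zeros w i n ≡ t
zeros-ivt w n = ivt (λ i → zeros w i n) (λ i → zeros-slide-up w i n) (λ i → zeros-slide-down w i n)

-- Φ as the fixed point of σ

W : ℕ → List Letter
W k = iterσ k (zero' ∷ [])

σ-length : ∀ x → length (σ x) ≡ 5
σ-length Fin.zero    = refl
σ-length (Fin.suc _) = refl

σ*-length : ∀ u → length (σ* u) ≡ length u * 5
σ*-length []      = refl
σ*-length (x ∷ u) = trans (length-++ (σ x)) (cong₂ _+_ (σ-length x) (σ*-length u))

W-length : ∀ k → k < length (W k)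
W-length zero    = s≤s z≤n
W-length (suc k) = begin-strict
  suc k              <⟨ s≤s (s≤s (≤-trans (m≤m*n k 5) (m≤n+m (k * 5) 3))) ⟩
  suc k * 5          ≤⟨ *-monoˡ-≤ 5 (W-length k) ⟩
  length (W k) * 5   ≡⟨ sym (σ*-length (W k)) ⟩
  length (W (suc k)) ∎
  where open ≤-Reasoning

W-extends : ∀ k → ∃[ r ] W (suc k) ≡ W k ++ r
W-extends zero    = zero' ∷ one' ∷ zero' ∷ one' ∷ [] , refl
W-extends (suc k) with W-extends k
... | r , eq = σ* r , trans (cong σ* eq) (concatMap-++ σ (W k) r)

W-prefix : ∀ k d → ∃[ r ] W (k + d) ≡ W k ++ r
W-prefix k zero    = [] , trans (cong W (+-identityʳ k)) (sym (++-identityʳ (W k)))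
W-prefix k (suc d) with W-prefix k d | W-extends (k + d)
... | r , eq | r′ , eq′ = r ++ r′ ,
  trans (cong W (+-suc k d)) (trans eq′ (trans (cong (_++ r′) eq) (++-assoc (W k) r r′)))

at-++ : ∀ xs ys j → j < length xs → at (xs ++ ys) j ≡ at xs j
at-++ (x ∷ xs) ys zero    _         = refl
at-++ (x ∷ xs) ys (suc j) (s≤s j<n) = at-++ xs ys j j<n

at-W : ∀ {k m} j → k ≤ m → j < length (W k) → at (W m) j ≡ at (W k) j
at-W {k} j k≤m j<len with W-prefix k (_ ∸ k)
... | r , eq = trans (cong (λ p → at (W p) j) (sym (m+[n∸m]≡n k≤m)))
                     (trans (cong (λ u → at u j) eq) (at-++ (W k) r j j<len))

Φ-at : ∀ k j → j < length (W k) → Φ j ≡ at (W k) j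
Φ-at k j j<len with ≤-total (suc j) k
... | inj₁ j<k = sym (at-W j j<k (≤-trans (n≤1+n (suc j)) (W-length (suc j))))
... | inj₂ k≤j = at-W j k≤j j<len

at-σ-++ : ∀ x ys k → at (σ x ++ ys) (5 + k) ≡ at ys k
at-σ-++ Fin.zero    ys k = refl
at-σ-++ (Fin.suc _) ys k = refl

at-σ* : ∀ u i r → i < length u → r < 5 → at (σ* u) (i * 5 + r) ≡ at (σ (at u i)) r
at-σ* (x ∷ u) zero    r _         r<5 = at-++ (σ x) (σ* u) r (subst (r <_) (sym (σ-length x)) r<5)
at-σ* (x ∷ u) (suc i) r (s≤s i<n) r<5 =
  trans (cong (at (σ x ++ σ* u)) (+-assoc 5 (i * 5) r)) (trans (at-σ-++ x (σ* u) (i * 5 + r)) (at-σ* u i r i<n r<5))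

-- Φ = σ(Φ): the i-th block of five letters of Φ is σ(Φ i)
-- (Φ i is, by definition, letter i of W (i + 1), and W (i + 2) = σ*(W (i + 1)))
Φ-σ : ∀ i r → r < 5 → Φ (i * 5 + r) ≡ at (σ (Φ i)) r
Φ-σ i r r<5 = trans (Φ-at (suc (suc i)) (i * 5 + r) in-range) (at-σ* (W (suc i)) i r i<len r<5)
  where
  i<len : i < length (W (suc i))
  i<len = ≤-trans (n≤1+n (suc i)) (W-length (suc i))
  in-range : i * 5 + r < length (W (suc (suc i)))
  in-range = begin-strict
    i * 5 + r                 <⟨ +-monoʳ-< (i * 5) r<5 ⟩
    i * 5 + 5                 ≡⟨ +-comm (i * 5) 5 ⟩
    suc i * 5                 ≤⟨ *-monoˡ-≤ 5 i<len ⟩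
    length (W (suc i)) * 5    ≡⟨ sym (σ*-length (W (suc i))) ⟩
    length (W (suc (suc i)))  ∎
    where open ≤-Reasoning

-- Arithmetic behind the propagation step: a window of length m scaled by σ and
-- extended by r < 5 letters gains one unit of excess, provided C ≥ 4.

rich-arith : ∀ m r C z z′ → 4 ≤ C → r < 5 → m + 3 * C ≤ 3 * z + 2 → m + 2 * z ≤ z′ →
             r + m * 5 + 3 * suc C ≤ 3 * z′ + 2
rich-arith m r C z z′ 4≤C r<5 rich grow = +-cancelʳ-≤ 2 _ _ (begin
  r + m * 5 + 3 * suc C + 2    ≡⟨ solve (r ∷ m ∷ C ∷ []) ⟩
  (r + 5) + (m * 5 + 3 * C)    ≤⟨ +-monoˡ-≤ _ r+5≤3C ⟩
  3 * C + (m * 5 + 3 * C)      ≡⟨ solve (m ∷ C ∷ []) ⟩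
  m * 3 + 2 * (m + 3 * C)      ≤⟨ +-monoʳ-≤ (m * 3) (*-monoʳ-≤ 2 rich) ⟩
  m * 3 + 2 * (3 * z + 2)      ≡⟨ solve (m ∷ z ∷ []) ⟩
  3 * (m + 2 * z) + 4          ≤⟨ +-monoˡ-≤ 4 (*-monoʳ-≤ 3 grow) ⟩
  3 * z′ + 4                   ≡⟨ solve (z′ ∷ []) ⟩
  3 * z′ + 2 + 2               ∎)
  where
  open ≤-Reasoning
  r+5≤3C : r + 5 ≤ 3 * C
  r+5≤3C = ≤-trans (+-monoˡ-≤ 5 (s≤s⁻¹ r<5)) (≤-trans (m≤m+n 9 3) (*-monoʳ-≤ 3 4≤C))

poor-arith : ∀ m r C z z′ → 4 ≤ C → r < 5 → 3 * z + 3 * C ≤ m → z′ ≤ m + 2 * z + r →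
             3 * z′ + 3 * suc C ≤ r + m * 5
poor-arith m r C z z′ 4≤C r<5 poor shrink = begin
  3 * z′ + 3 * suc C                             ≤⟨ +-monoˡ-≤ (3 * suc C) (*-monoʳ-≤ 3 shrink) ⟩
  3 * (m + 2 * z + r) + 3 * suc C                ≡⟨ solve (m ∷ z ∷ r ∷ C ∷ []) ⟩
  (2 * r + 3) + (r + m * 3 + 2 * (3 * z) + 3 * C) ≤⟨ +-monoˡ-≤ _ 2r+3≤3C ⟩
  3 * C + (r + m * 3 + 2 * (3 * z) + 3 * C)      ≡⟨ solve (m ∷ z ∷ r ∷ C ∷ []) ⟩
  r + m * 3 + 2 * (3 * z + 3 * C)                ≤⟨ +-monoʳ-≤ (r + m * 3) (*-monoʳ-≤ 2 poor) ⟩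
  r + m * 3 + 2 * m                              ≡⟨ solve (r ∷ m ∷ []) ⟩
  r + m * 5                                      ∎
  where
  open ≤-Reasoning
  2r+3≤3C : 2 * r + 3 ≤ 3 * C
  2r+3≤3C = ≤-trans (+-monoˡ-≤ 3 (*-monoʳ-≤ 2 (s≤s⁻¹ r<5))) (≤-trans (n≤1+n 11) (*-monoʳ-≤ 3 4≤C))

module SelfSimilar (w : Word) (w-σ : ∀ i r → r < 5 → w (i * 5 + r) ≡ at (σ (w i)) r) where

  σ-zeros : ∀ x → count zero' (take 5 (σ x)) ≡ 1 + 2 * isZero x
  σ-zeros Fin.zero    = refl
  σ-zeros (Fin.suc _) = refl

  zeros-block : ∀ i → zeros w (i * 5) 5 ≡ 1 + 2 * isZero (w i)
  zeros-block i = trans (zeros-at w (i * 5) 5 (σ (w i)) (≤-reflexive (sym (σ-length (w i)))) (w-σ i))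
                        (σ-zeros (w i))

  zeros-scaled : ∀ i m → zeros w (i * 5) (m * 5) ≡ m + 2 * zeros w i m
  zeros-scaled i zero    = refl
  zeros-scaled i (suc m) = begin
    zeros w (i * 5) (5 + m * 5)                         ≡⟨ zeros-++ w (i * 5) 5 (m * 5) ⟩
    zeros w (i * 5) 5 + zeros w (i * 5 + 5) (m * 5)     ≡⟨ cong₂ _+_ (zeros-block i)
                                                           (cong (λ p → zeros w p (m * 5)) (+-comm (i * 5) 5)) ⟩
    (1 + 2 * isZero (w i)) + zeros w (suc i * 5) (m * 5) ≡⟨ cong ((1 + 2 * isZero (w i)) +_) (zeros-scaled (suc i) m) ⟩
    (1 + 2 * isZero (w i)) + (m + 2 * zeros w (suc i) m) ≡⟨ regroup (isZero (w i)) (zeros w (suc i) m) ⟩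
    suc m + 2 * (isZero (w i) + zeros w (suc i) m)       ∎
    where
    open ≡-Reasoning
    regroup : ∀ d z → (1 + 2 * d) + (m + 2 * z) ≡ suc m + 2 * (d + z)
    regroup d z = solve (d ∷ z ∷ m ∷ [])

  -- a window of length n with at least ⌊n/3⌋ + C zeros (stated without division)
  Rich : ℕ → ℕ → Set
  Rich C n = ∃[ a ] n + 3 * C ≤ 3 * zeros w a n + 2

  -- a window of length n with at most ⌊n/3⌋ - C zeros
  Poor : ℕ → ℕ → Set
  Poor C n = ∃[ b ] 3 * zeros w b n + 3 * C ≤ n

  Spread : ℕ → ℕ → Set
  Spread C n = Rich C n × Poor C n

  spread-mono : ∀ {C C′ n} → C ≤ C′ → Spread C′ n → Spread C n
  spread-mono {n = n} C≤C′ ((a , rich) , (b , poor)) =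
    (a , ≤-trans (+-monoʳ-≤ n (*-monoʳ-≤ 3 C≤C′)) rich) ,
    (b , ≤-trans (+-monoʳ-≤ (3 * zeros w b n) (*-monoʳ-≤ 3 C≤C′)) poor)

  spread-step : ∀ {C m r} → 4 ≤ C → r < 5 → Spread C m → Spread (suc C) (r + m * 5)
  spread-step {C} {m} {r} 4≤C r<5 ((a , rich) , (b , poor)) =
    (a * 5 , rich-arith m r C (zeros w a m) (zeros w (a * 5) (r + m * 5)) 4≤C r<5 rich (begin
      m + 2 * zeros w a m            ≡⟨ sym (zeros-scaled a m) ⟩
      zeros w (a * 5) (m * 5)        ≤⟨ zeros-extend-≥ w (a * 5) (m * 5) r ⟩
      zeros w (a * 5) (m * 5 + r)    ≡⟨ cong (zeros w (a * 5)) (+-comm (m * 5) r) ⟩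
      zeros w (a * 5) (r + m * 5)    ∎)) ,
    (b * 5 , poor-arith m r C (zeros w b m) (zeros w (b * 5) (r + m * 5)) 4≤C r<5 poor (begin
      zeros w (b * 5) (r + m * 5)    ≡⟨ cong (zeros w (b * 5)) (+-comm r (m * 5)) ⟩
      zeros w (b * 5) (m * 5 + r)    ≤⟨ zeros-extend-≤ w (b * 5) (m * 5) r ⟩
      zeros w (b * 5) (m * 5) + r    ≡⟨ cong (_+ r) (zeros-scaled b m) ⟩
      m + 2 * zeros w b m + r        ∎))
    where open ≤-Reasoning

  rich-bound : ∀ {C n} → Rich C n → ∃[ a ] n / 3 + C ≤ zeros w a n
  rich-bound {C} {n} (a , rich) = a , s≤s⁻¹ (*-cancelˡ-< 3 (n / 3 + C) (suc (zeros w a n)) (begin-strict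
    3 * (n / 3 + C)          ≡⟨ *-distribˡ-+ 3 (n / 3) C ⟩
    3 * (n / 3) + 3 * C      ≤⟨ +-monoˡ-≤ (3 * C) (≤-trans (≤-reflexive (*-comm 3 (n / 3))) (m/n*n≤m n 3)) ⟩
    n + 3 * C                ≤⟨ rich ⟩
    3 * zeros w a n + 2      <⟨ +-monoʳ-< (3 * zeros w a n) (n<1+n 2) ⟩
    3 * zeros w a n + 3      ≡⟨ +-comm (3 * zeros w a n) 3 ⟩
    3 + 3 * zeros w a n      ≡⟨ sym (*-suc 3 (zeros w a n)) ⟩
    3 * suc (zeros w a n)    ∎))
    where open ≤-Reasoning

  poor-bound : ∀ {C n} → Poor C n → ∃[ b ] zeros w b n + C ≤ n / 3
  poor-bound {C} {n} (b , poor) = b , (begin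
    zeros w b n + C                ≡⟨ sym (m*n/n≡m (zeros w b n + C) 3) ⟩
    (zeros w b n + C) * 3 / 3      ≤⟨ /-monoˡ-≤ 3 (≤-trans (≤-reflexive times3) poor) ⟩
    n / 3                          ∎)
    where
    open ≤-Reasoning
    times3 : (zeros w b n + C) * 3 ≡ 3 * zeros w b n + 3 * C
    times3 = trans (*-comm (zeros w b n + C) 3) (*-distribˡ-+ 3 (zeros w b n) C)

  spread-realises : ∀ {C n} → Spread C n → ∀ {t} → t ≤ n / 3 + C → n / 3 ≤ t + C → ∃[ i ] zeros w i n ≡ t
  spread-realises {C} {n} (rich , poor) {t} t≤q+C q≤t+C with rich-bound {C} {n} rich | poor-bound {C} {n} poor
  ... | a , q+C≤za | b , zb+C≤q =
    zeros-ivt w n b a (+-cancelʳ-≤ C (zeros w b n) t (≤-trans zb+C≤q q≤t+C)) (≤-trans t≤q+C q+C≤za)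

  spread-C≤n/3 : ∀ {C n} → Spread C n → C ≤ n / 3
  spread-C≤n/3 {C} {n} (_ , poor) with poor-bound {C} {n} poor
  ... | b , zb+C≤q = ≤-trans (m≤n+m C (zeros w b n)) zb+C≤q

open SelfSimilar Φ Φ-σ

-- Base case C = 4 for 132 ≤ n < 660, certified by computation on σ⁶(0),
-- a prefix of Φ of length 5⁶ = 15625.

at-drop : ∀ b (xs : List Letter) j → at (drop b xs) j ≡ at xs (b + j)
at-drop zero    xs       j = refl
at-drop (suc b) []       j = refl
at-drop (suc b) (x ∷ xs) j = at-drop b xs j

-- σ⁶(0) is opaque: it is unfolded only where its letters are actually needed,
-- so that the rest of the development never normalises a list of 15625 letters
opaque
  prefix₆ : List Letter
  prefix₆ = W 6

opaque
  unfolding prefix₆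

  prefix₆-length : length prefix₆ ≡ 15625
  prefix₆-length = refl

  Φ-prefix₆ : ∀ j → j < 15625 → Φ j ≡ at prefix₆ j
  Φ-prefix₆ = Φ-at 6

zerosIn : List Letter → ℕ → ℕ → ℕ
zerosIn xs b n = count zero' (take n (drop b xs))

zeros-Φ≡zerosIn : ∀ b n → b + n ≤ 15625 → zeros Φ b n ≡ zerosIn prefix₆ b n
zeros-Φ≡zerosIn b n b+n≤ = zeros-at Φ b n (drop b prefix₆) n≤length agree
  where
  n≤length : n ≤ length (drop b prefix₆)
  n≤length = subst (n ≤_) (sym (trans (length-drop b prefix₆) (cong (_∸ b) prefix₆-length)))
                   (m+n≤o⇒m≤o∸n n (subst (_≤ 15625) (+-comm b n) b+n≤))
  agree : ∀ j → j < n → Φ (b + j) ≡ at (drop b prefix₆) j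
  agree j j<n = trans (Φ-prefix₆ (b + j) (≤-trans (+-monoʳ-< b j<n) b+n≤)) (sym (at-drop b prefix₆ j))

-- for C = 4: the window of length n at 0 is rich and the one at b is poor
certified : List Letter → ℕ → ℕ → Bool
certified xs n b = (n + 12 ≤ᵇ 3 * zerosIn xs 0 n + 2) ∧ (3 * zerosIn xs b n + 12 ≤ᵇ n) ∧ (b + n ≤ᵇ 15625)

all-certified : List Letter → ℕ → List ℕ → Bool
all-certified xs n₀ []       = true
all-certified xs n₀ (b ∷ bs) = certified xs n₀ b ∧ all-certified xs (suc n₀) bs

split-T : ∀ {x y} → T (x ∧ y) → T x × T y
split-T = Equivalence.to T-∧

certified-lookup : ∀ xs n₀ bs → T (all-certified xs n₀ bs) →
                   ∀ n → n₀ ≤ n → n < n₀ + length bs → ∃[ b ] T (certified xs n b)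
certified-lookup xs n₀ []       _  n n₀≤n n<n₀ =
  ⊥-elim (<-irrefl refl (≤-trans (subst (n <_) (+-identityʳ n₀) n<n₀) n₀≤n))
certified-lookup xs n₀ (b ∷ bs) ok n n₀≤n n<   with n₀ ≟ n
... | yes refl = b , proj₁ (split-T ok)
... | no  n₀≢n = certified-lookup xs (suc n₀) bs (proj₂ (split-T ok)) n (≤∧≢⇒< n₀≤n n₀≢n)
                   (subst (n <_) (+-suc n₀ (length bs)) n<)

certified⇒spread : ∀ n b → n < 660 → T (certified prefix₆ n b) → Spread 4 n
certified⇒spread n b n<660 ok with split-T {n + 12 ≤ᵇ 3 * zerosIn prefix₆ 0 n + 2} ok
... | rich , rest with split-T {3 * zerosIn prefix₆ b n + 12 ≤ᵇ n} {b + n ≤ᵇ 15625} rest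
... | poor , in-range =
  (0 , subst (λ z → n + 12 ≤ 3 * z + 2) (sym (zeros-Φ≡zerosIn 0 n (≤-trans (<⇒≤ n<660) (m≤m+n 660 _))))
         (≤ᵇ⇒≤ _ _ rich)) ,
  (b , subst (λ z → 3 * z + 12 ≤ n) (sym (zeros-Φ≡zerosIn b n (≤ᵇ⇒≤ _ _ in-range))) (≤ᵇ⇒≤ _ _ poor))

-- a poor position for each n = 132, …, 659 (the rich window is always the one at 0)
poor-positions : List ℕ
poor-positions = 219 ∷ 219 ∷ 223 ∷ 217 ∷ 219 ∷ 219 ∷ 217 ∷ 217 ∷ 217 ∷ 216 ∷ 217 ∷ 217 ∷ 213 ∷ 1111 ∷ 1111 ∷ 209 ∷ 209 ∷ 223 ∷ 207 ∷ 209 ∷ 219 ∷ 207 ∷ 217 ∷ 217 ∷ 216 ∷ 217 ∷ 217 ∷ 213 ∷ 1091 ∷ 1091 ∷ 209 ∷ 209 ∷ 1088 ∷ 207 ∷ 209 ∷ 1084 ∷ 207 ∷ 1082 ∷ 1082 ∷ 1081 ∷ 1082 ∷ 1082 ∷ 1081 ∷ 1081 ∷ 1081 ∷ 1079 ∷ 1079 ∷ 1081 ∷ 1077 ∷ 1079 ∷ 1084 ∷ 1077 ∷ 1082 ∷ 1082 ∷ 1081 ∷ 1082 ∷ 1082 ∷ 1068 ∷ 1081 ∷ 1081 ∷ 1064 ∷ 1064 ∷ 1081 ∷ 1062 ∷ 1064 ∷ 1079 ∷ 1062 ∷ 1077 ∷ 1077 ∷ 1076 ∷ 1077 ∷ 1077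 ∷ 1048 ∷ 1076 ∷ 1076 ∷ 1044 ∷ 1044 ∷ 1048 ∷ 1042 ∷ 1044 ∷ 1044 ∷ 1042 ∷ 1042 ∷ 1042 ∷ 1041 ∷ 1042 ∷ 1042 ∷ 1038 ∷ 1061 ∷ 1061 ∷ 1034 ∷ 1034 ∷ 1048 ∷ 1032 ∷ 1034 ∷ 1044 ∷ 1032 ∷ 1042 ∷ 1042 ∷ 1041 ∷ 1042 ∷ 1042 ∷ 1038 ∷ 1041 ∷ 1041 ∷ 1034 ∷ 1034 ∷ 1038 ∷ 1032 ∷ 1034 ∷ 1034 ∷ 1032 ∷ 1032 ∷ 1032 ∷ 1031 ∷ 1032 ∷ 1032 ∷ 1031 ∷ 1031 ∷ 1031 ∷ 1029 ∷ 1029 ∷ 1031 ∷ 1027 ∷ 1029 ∷ 1034 ∷ 1027 ∷ 1032 ∷ 1032 ∷ 1031 ∷ 1032 ∷ 1032 ∷ 1031 ∷ 1031 ∷ 1031 ∷ 1029 ∷ 1029 ∷ 1031 ∷ 1027 ∷ 1029 ∷ 1079 ∷ 1027 ∷ 1077 ∷ 1077 ∷ 1076 ∷ 1077 ∷ 1077 ∷ 1048 ∷ 1076 ∷ 1076 ∷ 1044 ∷ 1044 ∷ 1048 ∷ 1042 ∷ 1044 ∷ 1044 ∷ 1042 ∷ 1042 ∷ 1042 ∷ 1041 ∷ 1042 ∷ 1042 ∷ 1038 ∷ 1061 ∷ 1061 ∷ 1034 ∷ 1034 ∷ 1048 ∷ 1032 ∷ 1034 ∷ 1044 ∷ 1032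 ∷ 1042 ∷ 1042 ∷ 1041 ∷ 1042 ∷ 1042 ∷ 1038 ∷ 1041 ∷ 1041 ∷ 1034 ∷ 1034 ∷ 1038 ∷ 1032 ∷ 1034 ∷ 1034 ∷ 1032 ∷ 1032 ∷ 1032 ∷ 1031 ∷ 1032 ∷ 1032 ∷ 1031 ∷ 1031 ∷ 1031 ∷ 1029 ∷ 1029 ∷ 1031 ∷ 1027 ∷ 1029 ∷ 1034 ∷ 1027 ∷ 1032 ∷ 1032 ∷ 1031 ∷ 1032 ∷ 1032 ∷ 1031 ∷ 1031 ∷ 1031 ∷ 1029 ∷ 1029 ∷ 1031 ∷ 1027 ∷ 1029 ∷ 1029 ∷ 1027 ∷ 1027 ∷ 1027 ∷ 1026 ∷ 1027 ∷ 1027 ∷ 1023 ∷ 1026 ∷ 1026 ∷ 1019 ∷ 1019 ∷ 1023 ∷ 1017 ∷ 1019 ∷ 1019 ∷ 1017 ∷ 1017 ∷ 1017 ∷ 1016 ∷ 1017 ∷ 1017 ∷ 1013 ∷ 1026 ∷ 1026 ∷ 1009 ∷ 1009 ∷ 1023 ∷ 1007 ∷ 1009 ∷ 1019 ∷ 1007 ∷ 1017 ∷ 1017 ∷ 1016 ∷ 1017 ∷ 1017 ∷ 1013 ∷ 1016 ∷ 1016 ∷ 1009 ∷ 1009 ∷ 1013 ∷ 1007 ∷ 1009 ∷ 1009 ∷ 1007 ∷ 1007 ∷ 1007 ∷ 1006 ∷ 1007 ∷ 1007 ∷ 1006 ∷ 1006 ∷ 1006 ∷ 1004 ∷ 1004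 ∷ 1006 ∷ 1002 ∷ 1004 ∷ 1009 ∷ 1002 ∷ 1007 ∷ 1007 ∷ 1006 ∷ 1007 ∷ 1007 ∷ 868 ∷ 1006 ∷ 1006 ∷ 864 ∷ 864 ∷ 1006 ∷ 862 ∷ 864 ∷ 1029 ∷ 862 ∷ 1027 ∷ 1027 ∷ 1026 ∷ 1027 ∷ 1027 ∷ 848 ∷ 1026 ∷ 1026 ∷ 844 ∷ 844 ∷ 848 ∷ 842 ∷ 844 ∷ 844 ∷ 842 ∷ 842 ∷ 842 ∷ 841 ∷ 842 ∷ 842 ∷ 838 ∷ 961 ∷ 961 ∷ 834 ∷ 834 ∷ 848 ∷ 832 ∷ 834 ∷ 844 ∷ 832 ∷ 842 ∷ 842 ∷ 841 ∷ 842 ∷ 842 ∷ 838 ∷ 941 ∷ 941 ∷ 834 ∷ 834 ∷ 938 ∷ 832 ∷ 834 ∷ 934 ∷ 832 ∷ 932 ∷ 932 ∷ 931 ∷ 932 ∷ 932 ∷ 931 ∷ 931 ∷ 931 ∷ 929 ∷ 929 ∷ 931 ∷ 927 ∷ 929 ∷ 934 ∷ 927 ∷ 932 ∷ 932 ∷ 931 ∷ 932 ∷ 932 ∷ 868 ∷ 931 ∷ 931 ∷ 864 ∷ 864 ∷ 931 ∷ 862 ∷ 864 ∷ 5879 ∷ 862 ∷ 5877 ∷ 5877 ∷ 5876 ∷ 5877 ∷ 5877 ∷ 848 ∷ 5876 ∷ 5876 ∷ 844 ∷ 844 ∷ 848 ∷ 842 ∷ 844 ∷ 844 ∷ 842 ∷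 842 ∷ 842 ∷ 841 ∷ 842 ∷ 842 ∷ 838 ∷ 861 ∷ 861 ∷ 834 ∷ 834 ∷ 848 ∷ 832 ∷ 834 ∷ 844 ∷ 832 ∷ 842 ∷ 842 ∷ 841 ∷ 842 ∷ 842 ∷ 838 ∷ 841 ∷ 841 ∷ 834 ∷ 834 ∷ 838 ∷ 832 ∷ 834 ∷ 834 ∷ 832 ∷ 832 ∷ 832 ∷ 831 ∷ 832 ∷ 832 ∷ 831 ∷ 831 ∷ 831 ∷ 829 ∷ 829 ∷ 831 ∷ 827 ∷ 829 ∷ 834 ∷ 827 ∷ 832 ∷ 832 ∷ 831 ∷ 832 ∷ 832 ∷ 818 ∷ 831 ∷ 831 ∷ 814 ∷ 814 ∷ 831 ∷ 812 ∷ 814 ∷ 829 ∷ 812 ∷ 827 ∷ 827 ∷ 826 ∷ 827 ∷ 827 ∷ 798 ∷ 826 ∷ 826 ∷ 794 ∷ 794 ∷ 798 ∷ 792 ∷ 794 ∷ 794 ∷ 792 ∷ 792 ∷ 792 ∷ 791 ∷ 792 ∷ 792 ∷ 788 ∷ 811 ∷ 811 ∷ 784 ∷ 784 ∷ 798 ∷ 782 ∷ 784 ∷ 794 ∷ 782 ∷ 792 ∷ 792 ∷ 791 ∷ 792 ∷ 792 ∷ 788 ∷ 791 ∷ 791 ∷ 784 ∷ 784 ∷ 788 ∷ 782 ∷ 784 ∷ 784 ∷ 782 ∷ 782 ∷ 782 ∷ 781 ∷ 782 ∷ 782 ∷ 781 ∷ 781 ∷ 781 ∷ 779 ∷ 779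 ∷ 781 ∷ 777 ∷ 779 ∷ 784 ∷ 777 ∷ 782 ∷ 782 ∷ 781 ∷ 782 ∷ 782 ∷ 781 ∷ 781 ∷ 781 ∷ 779 ∷ 779 ∷ 781 ∷ 777 ∷ 779 ∷ 829 ∷ 777 ∷ 827 ∷ 827 ∷ 826 ∷ 827 ∷ 827 ∷ 798 ∷ 826 ∷ 826 ∷ 794 ∷ 794 ∷ 798 ∷ []

opaque
  unfolding prefix₆
  certificate : T (all-certified prefix₆ 132 poor-positions)
  certificate = tt

spread-base : ∀ n → 132 ≤ n → n < 660 → Spread 4 n
spread-base n 132≤n n<660 with certified-lookup prefix₆ 132 poor-positions certificate n 132≤n n<660
... | b , ok = certified⇒spread n b n<660 ok

-- From the base range to all n ≥ N_C

-- every n ≥ 660 is 5m + r with r < 5 and m ≥ 132, so Spread 4 follows by strong induction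
spread-4 : ∀ n → 132 ≤ n → Spread 4 n
spread-4 = <-rec (λ n → 132 ≤ n → Spread 4 n) go
  where
  go : ∀ n → (∀ {m} → m < n → 132 ≤ m → Spread 4 m) → 132 ≤ n → Spread 4 n
  go n rec 132≤n with n <? 660
  ... | yes n<660 = spread-base n 132≤n n<660
  ... | no  n≮660 = subst (Spread 4) (sym (m≡m%n+[m/n]*n n 5))
    (spread-mono (n≤1+n 4) (spread-step ≤-refl (m%n<n n 5)
      (rec (m/n<m n 5 {{>-nonZero (≤-trans (s≤s z≤n) 132≤n)}} (s≤s (s≤s z≤n)))
           (/-monoˡ-≤ {660} 5 (≮⇒≥ n≮660)))))

-- each factor 5 in the length bound buys one more unit of spread
spread-5^ : ∀ k n → 132 * 5 ^ k ≤ n → Spread (4 + k) n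
spread-5^ zero    n bound = spread-4 n bound
spread-5^ (suc k) n bound = subst (Spread (5 + k)) (sym (m≡m%n+[m/n]*n n 5))
  (spread-step (m≤m+n 4 k) (m%n<n n 5) (spread-5^ k (n / 5) quotient-bound))
  where
  regroup : ∀ x → 132 * (5 * x) ≡ 132 * x * 5
  regroup x = solve (x ∷ [])
  quotient-bound : 132 * 5 ^ k ≤ n / 5
  quotient-bound = subst (_≤ n / 5) (m*n/n≡m (132 * 5 ^ k) 5)
    (/-monoˡ-≤ 5 (subst (_≤ n) (regroup (5 ^ k)) bound))

spread : ∀ C n → 4 ≤ C → N C ≤ n → Spread C n
spread C n 4≤C bound = subst (λ c → Spread c n) (m+[n∸m]≡n 4≤C) (spread-5^ (C ∸ 4) n bound)

open import Data.Integer using (ℤ; +_; -[1+_]; -_; _-_) renaming (_+_ to _+ℤ_; _≤_ to _≤ℤ_)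
open import Data.Integer.Base using (+≤+; -≤-)
open import Data.Integer.Properties using (pos-+; ⊖-≥)
import Data.Integer.Tactic.RingSolver as ℤ-Solver

shifted-target : ∀ q C (D : ℤ) → C ≤ q → - (+ C) ≤ℤ D → D ≤ℤ + C →
                 ∃[ t ] (+ t ≡ + q +ℤ D × t ≤ q + C × q ≤ t + C)
shifted-target q C (+ d) _ _ (+≤+ d≤C) =
  q + d , refl , +-monoʳ-≤ q d≤C , ≤-trans (m≤m+n q d) (m≤m+n (q + d) C)
shifted-target q (suc c) -[1+ d ] C≤q (-≤- d≤c) _ =
  q ∸ suc d , sym (⊖-≥ sd≤q) , ≤-trans (m∸n≤m q (suc d)) (m≤m+n q (suc c)) , (begin
    q                     ≡⟨ sym (m∸n+n≡m sd≤q) ⟩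
    q ∸ suc d + suc d     ≤⟨ +-monoʳ-≤ (q ∸ suc d) (s≤s d≤c) ⟩
    q ∸ suc d + suc c     ∎)
  where
  open ≤-Reasoning
  sd≤q : suc d ≤ q
  sd≤q = ≤-trans (s≤s d≤c) C≤q

complement : ∀ o z n (q D : ℤ) → o + z ≡ n → + z ≡ q +ℤ D → + o ≡ (+ n - q) - D
complement o z n q D o+z≡n z≡q+D = begin
  + o                              ≡⟨ cancel (+ o) ⟩
  ((+ o +ℤ (q +ℤ D)) - q) - D      ≡⟨ cong (λ x → ((+ o +ℤ x) - q) - D) (sym z≡q+D) ⟩
  ((+ o +ℤ + z) - q) - D           ≡⟨ cong (λ x → (x - q) - D) (sym (pos-+ o z)) ⟩
  (+ (o + z) - q) - D              ≡⟨ cong (λ x → (+ x - q) - D) o+z≡n ⟩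
  (+ n - q) - D                    ∎
  where
  open ≡-Reasoning
  cancel : ∀ x → x ≡ ((x +ℤ (q +ℤ D)) - q) - D
  cancel x = ℤ-Solver.solve (x ∷ q ∷ D ∷ [])

corollary7 : (C : ℕ) → 4 ≤ C → (n : ℕ) → N C ≤ n →
    (D : ℤ) → - (+ C) ≤ℤ D → D ≤ℤ + C →
    ∃[ i ] ((+ proj₁ (ψ (factor i n)) ≡ + (n / 3) +ℤ D)
          × (+ proj₂ (ψ (factor i n)) ≡ (+ n - + (n / 3)) - D))
corollary7 C 4≤C n bound D -C≤D D≤C
  with spread C n 4≤C bound
... | spread-Cn
  with shifted-target (n / 3) C D (spread-C≤n/3 spread-Cn) -C≤D D≤C
... | t , t≡q+D , t≤q+C , q≤t+C
  with spread-realises spread-Cn t≤q+C q≤t+C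
... | i , zeros≡t =
  i , trans (cong +_ (trans (proj₁ (ψ-factor i n)) zeros≡t)) t≡q+D
    , complement (proj₂ (ψ (factor i n))) t n (+ (n / 3)) D
        (subst (λ z → _ + z ≡ n) zeros≡t (proj₂ (ψ-factor i n))) t≡q+D
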